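{- Let $\mathcal{G}$ be an $[n,k,d]_q$ A$^s$MDS code with $k\ge 3$, whose dual $\mathcal{G}^\perp$ is an $[n,k^\perp,d^\perp]_q$ A$^t$MDS code. If $t>1$ and $d>\alpha(q^2+q)-2q$ for an integer $\alpha\ge 0$, then \[ n\le (s+1-\alpha)(q+1)+k-2+\alpha. \]
   Context: A linear $[n,k,d]_q$ code is identified with a projective system: a finite multiset $\mathcal{G}$ of $n$ points (counted with multiplicity) of $\mathrm{PG}(k-1,q)$, not all lying in one hyperplane, with $n-d=\max_H|\mathcal{G}\cap H|$ over hyperplanes $H$ (counted with multiplicity); equivalently the columns of a generator matrix of a non-degenerate linear code $C\subseteq\mathbb{F}_q^n$. The Singleton defect is $n-k+1-d$; the code is A$^s$MDS if its defect is $s$. The dual $\mathcal{G}^\perp$ is $C^\perp$, of dimension $k^\perp=n-k$ and minimum distance $d^\perp$. -}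

module Defs where

open import Level using (Level; _⊔_)
open import Data.Nat using (ℕ; zero; suc; _≤_)
open import Data.Fin using (Fin)
import Data.Fin as Fin
open import Data.List using (List; filter; length; allFin)
open import Data.Product using (Σ; _×_; _,_)
open import Relation.Nullary using (¬_)
open import Relation.Nullary.Decidable using (¬?)
open import Relation.Binary using (Decidable)
open import Relation.Binary.PropositionalEquality using (_≡_)
open import Algebra.Bundles using (CommutativeRing)

-- We additionally require decidable equality (automatic for finite
-- fields, needed to count Hamming weights) and an enumeration
-- Fin q → Carrier which is injective and surjective (up to ≈),
-- i.e. the field has exactly q elements.

record FiniteField (c ℓ : Level) (q : ℕ) : Set (Level.suc (c ⊔ ℓ)) where
  field
    commRing : CommutativeRing c ℓ
  open CommutativeRing commRing public
  field
    _≟_      : Decidable _≈_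
    1≉0      : ¬ (1# ≈ 0#)
    inverse  : ∀ x → ¬ (x ≈ 0#) → Σ Carrier λ y → (x * y) ≈ 1#
    enum     : Fin q → Carrier
    enum-inj : ∀ i j → enum i ≈ enum j → i ≡ j
    enum-sur : ∀ x → Σ (Fin q) λ i → enum i ≈ x

module Codes {c ℓ : Level} {q : ℕ} (F : FiniteField c ℓ q) where
  open FiniteField F

  Vect : ℕ → Set c
  Vect n = Fin n → Carrier

  sumF : (n : ℕ) → (Fin n → Carrier) → Carrier
  sumF zero    f = 0#
  sumF (suc n) f = f Fin.zero + sumF n (λ i → f (Fin.suc i))

  IsZeroVec : {n : ℕ} → Vect n → Set ℓ
  IsZeroVec v = ∀ i → v i ≈ 0#

  weight : {n : ℕ} → Vect n → ℕ
  weight {n} v = length (filter (λ i → ¬? (v i ≟ 0#)) (allFin n))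

  Matrix : ℕ → ℕ → Set c
  Matrix k n = Fin k → Fin n → Carrier

  encode : {k n : ℕ} → Matrix k n → Vect k → Vect n
  encode {k} G x j = sumF k (λ i → x i * G i j)

  InCode : {k n : ℕ} → Matrix k n → Vect n → Set (c ⊔ ℓ)
  InCode {k} G v = Σ (Vect k) λ x → ∀ j → v j ≈ encode G x j

  InDual : {k n : ℕ} → Matrix k n → Vect n → Set ℓ
  InDual {k} {n} G y = ∀ i → sumF n (λ j → G i j * y j) ≈ 0#

  -- G is a generator matrix of a non-degenerate [n,k] code:
  -- its rows are linearly independent (C has dimension k, i.e. the
  -- columns do not all lie in a hyperplane of PG(k-1,q)), and no column
  -- is zero (every column is a point of PG(k-1,q)).
  IsNonDegGenerator : {k n : ℕ} → Matrix k n → Set (c ⊔ ℓ)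
  IsNonDegGenerator {k} {n} G =
    (∀ x → IsZeroVec (encode G x) → IsZeroVec x) ×
    (∀ j → ¬ (∀ i → G i j ≈ 0#))

  IsMinDistance : {p : Level} {n : ℕ} → (Vect n → Set p) → ℕ → Set (c ⊔ ℓ ⊔ p)
  IsMinDistance {n = n} P d =
    (Σ (Vect n) λ v → P v × ¬ IsZeroVec v × weight v ≡ d) ×
    (∀ v → P v → ¬ IsZeroVec v → d ≤ weight v)

{-# OPTIONS --safe #-}
-- Let u, v be messages whose codewords c_u, c_v are independent and vanish on a set Z
-- of coordinates. The q + 1 codewords c_v and c_u + a c_v (a ∈ F_q) all have weight at
-- least d, while each coordinate outside Z is nonzero in at most q of them, so
-- (q + 1) d + q |Z| ≤ q n. Together with n + 1 = k + d + s this yields the bound as soon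
-- as such a pencil with |Z| ≥ k - 2 + α exists. For α = 0, impose k - 2 linear
-- conditions. For α = 1, a minimum-weight dual codeword y has weight d⊥ ≤ k - 1 (as t ≥ 2),
-- so k - 2 conditions cover supp y minus one point j₀, and orthogonality to y forces a zero
-- at j₀ as well. For α ≥ 2 the hypothesis gives d > q² α: take three independent messages
-- vanishing on k - 3 coordinates with codewords c₀, c₁, c₂; pigeonholing the pairs
-- (c₁ j / c₀ j, c₂ j / c₀ j) over the ≥ d coordinates of supp c₀ yields (a, b) shared by
-- α + 1 coordinates, on which c₁ - a c₀ and c₂ - b c₀ both vanish.

module Submission where

open import Defs
open import Level using (Level; _⊔_)
open import Data.Bool using (Bool; true; false; T; not; _∧_; _∨_; if_then_else_)
open import Data.Bool.Properties using (∧-identityʳ; T-∧; T-∨)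
open import Function.Bundles using (Equivalence)
open import Data.Empty using (⊥; ⊥-elim)
open import Data.Fin using (Fin; zero; suc; punchIn)
import Data.Fin as Fin
open import Data.Fin.Properties using (¬∀⟶∃¬; punchInᵢ≢i)
open import Data.List using (List; []; _∷_; length; filter; filterᵇ; tabulate; allFin)
open import Data.Nat using (ℕ; zero; suc)
open import Data.Product using (Σ; ∃; _×_; _,_; proj₁; proj₂)
open import Function using (_∘_; id)
open import Relation.Nullary using (¬_; yes; no; does)
open import Relation.Nullary.Decidable using (T?; ⌊_⌋; toSum; toWitness; fromWitness)
open import Data.Sum using ([_,_]′)
open import Relation.Unary using (Pred; Decidable)
open import Relation.Binary.PropositionalEquality using (_≡_; _≢_)
import Relation.Binary.PropositionalEquality as ≡

module Counting where
  open import Data.Nat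
  open import Data.Nat.Properties
  open ≡ using (refl; sym; trans; cong; cong₂; subst; module ≡-Reasoning)

  open import Algebra.Properties.CommutativeMonoid.Sum +-0-commutativeMonoid public
    using (sum; sum-syntax; ∑-comm; ∑-distrib-+; sum-remove; sum-cong-≗)
  open import Algebra.Properties.Semiring.Sum +-*-semiring public using (*-distribˡ-sum)

  sum-mono-≤ : ∀ {n} {f g : Fin n → ℕ} → (∀ i → f i ≤ g i) → sum f ≤ sum g
  sum-mono-≤ {zero}  f≤g = z≤n
  sum-mono-≤ {suc n} f≤g = +-mono-≤ (f≤g zero) (sum-mono-≤ (f≤g ∘ suc))

  sum-≤-* : ∀ {n} c {f : Fin n → ℕ} → (∀ i → f i ≤ c) → sum f ≤ n * c
  sum-≤-* {zero}  c f≤c = z≤n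
  sum-≤-* {suc n} c f≤c = +-mono-≤ (f≤c zero) (sum-≤-* c (f≤c ∘ suc))

  *-≤-sum : ∀ {n} c {f : Fin n → ℕ} → (∀ i → c ≤ f i) → n * c ≤ sum f
  *-≤-sum {zero}  c c≤f = z≤n
  *-≤-sum {suc n} c c≤f = +-mono-≤ (c≤f zero) (*-≤-sum c (c≤f ∘ suc))

  ≤-sum : ∀ {n} (f : Fin n → ℕ) i → f i ≤ sum f
  ≤-sum {suc _} f i = ≤-trans (m≤m+n (f i) _) (≤-reflexive (sym (sum-remove {i = i} f)))

  pigeonhole : ∀ {n} a (f : Fin n → ℕ) → n * a < sum f → ∃ λ i → a < f i
  pigeonhole {n} a f n*a<∑f =
    let (i , fi≰a) = ¬∀⟶∃¬ n (λ i → f i ≤ a) (λ i → f i ≤? a) (<⇒≱ n*a<∑f ∘ sum-≤-* a)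
    in i , ≰⇒> fi≰a

  𝟙 : Bool → ℕ
  𝟙 true  = 1
  𝟙 false = 0

  𝟙≤1 : ∀ b → 𝟙 b ≤ 1
  𝟙≤1 true  = ≤-refl
  𝟙≤1 false = z≤n

  ∣_∣ : ∀ {n} → (Fin n → Bool) → ℕ
  ∣_∣ {n} Z = ∑[ j < n ] 𝟙 (Z j)

  length-filter-tabulate : ∀ {a p} {A : Set a} {P : Pred A p} (P? : Decidable P) {n} (f : Fin n → A) →
    length (filter P? (tabulate f)) ≡ ∣ does ∘ P? ∘ f ∣
  length-filter-tabulate P? {zero}  f = refl
  length-filter-tabulate P? {suc n} f with does (P? (f zero))
  ... | true  = cong suc (length-filter-tabulate P? (f ∘ suc))
  ... | false = length-filter-tabulate P? (f ∘ suc)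

  _⊆_ : ∀ {n} → (Fin n → Bool) → (Fin n → Bool) → Set
  A ⊆ B = ∀ {j} → T (A j) → T (B j)

  _∪_ : ∀ {n} → (Fin n → Bool) → (Fin n → Bool) → Fin n → Bool
  (A ∪ B) j = A j ∨ B j

  _∖_ : ∀ {n} → (Fin n → Bool) → Fin n → Fin n → Bool
  (A ∖ i) j = A j ∧ not (does (j Fin.≟ i))

  ∣∣≤n : ∀ {n} (Z : Fin n → Bool) → ∣ Z ∣ ≤ n
  ∣∣≤n {n} Z = ≤-trans (sum-≤-* 1 (𝟙≤1 ∘ Z)) (≤-reflexive (*-identityʳ n))

  ∣∅∣≡0 : ∀ n → ∣ (λ (_ : Fin n) → false) ∣ ≡ 0
  ∣∅∣≡0 zero    = refl
  ∣∅∣≡0 (suc n) = ∣∅∣≡0 n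

  ∣∣<n : ∀ {n} (Z : Fin n → Bool) {i} → Z i ≡ false → ∣ Z ∣ < n
  ∣∣<n {suc n} Z {i} Zi≡false = begin-strict
    ∣ Z ∣                         ≡⟨ sum-remove {i = i} (𝟙 ∘ Z) ⟩
    𝟙 (Z i) + ∣ Z ∘ punchIn i ∣   ≡⟨ cong (λ b → 𝟙 b + ∣ Z ∘ punchIn i ∣) Zi≡false ⟩
    ∣ Z ∘ punchIn i ∣             <⟨ s≤s (∣∣≤n (Z ∘ punchIn i)) ⟩
    suc n                         ∎
    where open ≤-Reasoning

  T⇒1≤𝟙 : ∀ {b} → T b → 1 ≤ 𝟙 b
  T⇒1≤𝟙 {true} _ = ≤-refl

  𝟙≤ : ∀ {b n} → (T b → 1 ≤ n) → 𝟙 b ≤ n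
  𝟙≤ {true}  1≤n = 1≤n _
  𝟙≤ {false} _   = z≤n

  1≤∣∣ : ∀ {n} (Z : Fin n → Bool) {j} → T (Z j) → 1 ≤ ∣ Z ∣
  1≤∣∣ Z {j} Zj = ≤-trans (T⇒1≤𝟙 Zj) (≤-sum (𝟙 ∘ Z) j)

  ∈-∖ : ∀ {n} (A : Fin n → Bool) {i j} → T (A j) → j ≢ i → T ((A ∖ i) j)
  ∈-∖ A {i} {j} Aj j≢i with j Fin.≟ i
  ... | yes j≡i = ⊥-elim (j≢i j≡i)
  ... | no  _   = subst T (sym (∧-identityʳ (A j))) Aj

  ∣∪∣-disjoint : ∀ {n} (A B : Fin n → Bool) → (∀ {j} → T (A j) → T (B j) → ⊥) →
    ∣ A ∪ B ∣ ≡ ∣ A ∣ + ∣ B ∣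
  ∣∪∣-disjoint {n} A B disjoint = begin
    ∑[ j < n ] 𝟙 (A j ∨ B j)       ≡⟨ sum-cong-≗ (λ j → 𝟙-∨ (A j) (B j) disjoint) ⟩
    ∑[ j < n ] (𝟙 (A j) + 𝟙 (B j)) ≡⟨ ∑-distrib-+ (𝟙 ∘ A) (𝟙 ∘ B) ⟩
    ∣ A ∣ + ∣ B ∣                   ∎
    where
    open ≡-Reasoning
    𝟙-∨ : ∀ a b → (T a → T b → ⊥) → 𝟙 (a ∨ b) ≡ 𝟙 a + 𝟙 b
    𝟙-∨ true  true  a∧b = ⊥-elim (a∧b _ _)
    𝟙-∨ true  false _   = refl
    𝟙-∨ false b     _   = refl

  ∣∖∣ : ∀ {n} (Z : Fin n → Bool) {i} → T (Z i) → suc ∣ Z ∖ i ∣ ≡ ∣ Z ∣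
  ∣∖∣ {suc n} Z {i} Zi with Z i in eq
  ... | true = begin
    suc ∣ Z ∖ i ∣                                   ≡⟨ cong suc (sum-remove {i = i} (𝟙 ∘ (Z ∖ i))) ⟩
    suc (𝟙 ((Z ∖ i) i) + ∑[ j < n ] 𝟙 ((Z ∖ i) (punchIn i j)))
      ≡⟨ cong₂ (λ a b → suc (𝟙 a + b)) i∉Z∖i (sum-cong-≗ (cong 𝟙 ∘ Z∖i≗Z)) ⟩
    suc (∑[ j < n ] 𝟙 (Z (punchIn i j)))
      ≡⟨ cong (λ b → 𝟙 b + ∑[ j < n ] 𝟙 (Z (punchIn i j))) (sym eq) ⟩
    𝟙 (Z i) + ∑[ j < n ] 𝟙 (Z (punchIn i j))        ≡⟨ sum-remove {i = i} (𝟙 ∘ Z) ⟨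
    ∣ Z ∣                                           ∎
    where
    open ≡-Reasoning
    i∉Z∖i : (Z ∖ i) i ≡ false
    i∉Z∖i rewrite eq with i Fin.≟ i
    ... | yes _  = refl
    ... | no i≢i = ⊥-elim (i≢i refl)
    Z∖i≗Z : ∀ j → (Z ∖ i) (punchIn i j) ≡ Z (punchIn i j)
    Z∖i≗Z j with punchIn i j Fin.≟ i
    ... | yes pj≡i = ⊥-elim (punchInᵢ≢i i j pj≡i)
    ... | no  _    = ∧-identityʳ (Z (punchIn i j))

  ∃-superset-of-size : ∀ {n} (P : Fin n → Bool) m → ∣ P ∣ ≤ m → m ≤ n →
    Σ (Fin n → Bool) λ Z → P ⊆ Z × ∣ Z ∣ ≡ m
  ∃-superset-of-size {zero} P m _ m≤0 = P , id , sym (n≤0⇒n≡0 m≤0)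
  ∃-superset-of-size {suc n} P m ∣P∣≤m m≤1+n with P zero in eq
  ∃-superset-of-size {suc n} P (suc m) (s≤s ∣P∣≤m) (s≤s m≤n) | true =
    let (Z , P⊆Z , ∣Z∣≡m) = ∃-superset-of-size (P ∘ suc) m ∣P∣≤m m≤n
    in (λ { zero → true ; (suc j) → Z j }) , (λ { {zero} _ → _ ; {suc j} → P⊆Z }) , cong suc ∣Z∣≡m
  ... | false with m ≤? n
  ...   | yes m≤n =
    let (Z , P⊆Z , ∣Z∣≡m) = ∃-superset-of-size (P ∘ suc) m ∣P∣≤m m≤n
    in (λ { zero → false ; (suc j) → Z j }) ,
       (λ { {zero} P0 → ⊥-elim (subst T eq P0) ; {suc j} → P⊆Z }) , ∣Z∣≡m
  ...   | no m≰n =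
    let (Z , P⊆Z , ∣Z∣≡n) = ∃-superset-of-size (P ∘ suc) n (∣∣≤n (P ∘ suc)) ≤-refl
    in (λ { zero → true ; (suc j) → Z j }) , (λ { {zero} _ → _ ; {suc j} → P⊆Z }) ,
       trans (cong suc ∣Z∣≡n) (≤-antisym (≰⇒> m≰n) m≤1+n)

  ∃-subset-of-size : ∀ {n} m → m ≤ n → Σ (Fin n → Bool) λ Z → ∣ Z ∣ ≡ m
  ∃-subset-of-size {n} m m≤n =
    let (Z , _ , ∣Z∣≡m) = ∃-superset-of-size (λ _ → false) m (subst (_≤ m) (sym (∣∅∣≡0 n)) z≤n) m≤n
    in Z , ∣Z∣≡m

module LinearAlgebra {c ℓ : Level} {q : ℕ} (F : FiniteField c ℓ q) where
  open FiniteField F hiding (zero)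
  open Codes F using (Vect; sumF)
  open import Algebra.Properties.CommutativeMonoid.Sum +-commutativeMonoid
    using (sum; sum-syntax; ∑-comm; ∑-distrib-+; sum-cong-≋; sum-remove; sum-replicate-zero)
  open import Algebra.Properties.Semiring.Sum semiring using (*-distribˡ-sum; *-distribʳ-sum)
  open import Algebra.Solver.Ring.NaturalCoefficients.Default commutativeSemiring
    using (solve; _:=_; _:+_; _:*_)
  open import Algebra.Properties.Ring ring using (-‿distribˡ-*)
  open import Data.Vec.Functional using (insertAt; removeAt)
  open import Data.Vec.Functional.Properties using (insertAt-lookup; insertAt-punchIn)
  open import Data.List using (map)
  open import Data.List.Properties using (length-map)
  open import Data.List.Relation.Unary.All using (All; []; _∷_)
  import Data.List.Relation.Unary.All as All
  open import Data.List.Relation.Unary.All.Properties using (map⁻)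
  open import Data.Nat as ℕ using (_≤_; s≤s)
  open import Data.Nat.Properties using (m≤n⇒m≤1+n)
  open import Data.Fin using (inject≤)
  open import Data.Fin.Properties using (all?; inject≤-injective)
  open import Relation.Binary.Reasoning.Setoid setoid

  infix 8 _·_
  _·_ : ∀ {k} → Vect k → Vect k → Carrier
  _·_ {k} u v = ∑[ i < k ] (u i * v i)

  sumF≡sum : ∀ n (f : Fin n → Carrier) → sumF n f ≡ sum f
  sumF≡sum zero    f = ≡.refl
  sumF≡sum (suc n) f = ≡.cong (f zero +_) (sumF≡sum n (f ∘ suc))

  ·-comm : ∀ {k} (u v : Vect k) → u · v ≈ v · u
  ·-comm u v = sum-cong-≋ (λ i → *-comm (u i) (v i))

  ·-linearʳ : ∀ {k} (u v w : Vect k) a → u · (λ i → v i + a * w i) ≈ u · v + a * (u · w)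
  ·-linearʳ {k} u v w a = begin
    ∑[ i < k ] (u i * (v i + a * w i))       ≈⟨ sum-cong-≋ (λ i → expand (u i) (v i) (w i)) ⟩
    ∑[ i < k ] (u i * v i + a * (u i * w i)) ≈⟨ ∑-distrib-+ (λ i → u i * v i) (λ i → a * (u i * w i)) ⟩
    u · v + ∑[ i < k ] (a * (u i * w i))     ≈⟨ +-congˡ (*-distribˡ-sum a (λ i → u i * w i)) ⟨
    u · v + a * (u · w)                      ∎
    where
    expand : ∀ s t r → s * (t + a * r) ≈ s * t + a * (s * r)
    expand = solve 4 (λ a s t r → s :* (t :+ a :* r) := s :* t :+ a :* (s :* r)) refl a

  ·-linearˡ : ∀ {k} (u v w : Vect k) a → (λ i → u i + a * v i) · w ≈ u · w + a * (v · w)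
  ·-linearˡ u v w a = begin
    (λ i → u i + a * v i) · w ≈⟨ ·-comm _ w ⟩
    w · (λ i → u i + a * v i) ≈⟨ ·-linearʳ w u v a ⟩
    w · u + a * (w · v)       ≈⟨ +-cong (·-comm w u) (*-congˡ (·-comm w v)) ⟩
    u · w + a * (v · w)       ∎

  ·-congˡ : ∀ {k} {u u′ : Vect k} (v : Vect k) → (∀ i → u i ≈ u′ i) → u · v ≈ u′ · v
  ·-congˡ v u≈u′ = sum-cong-≋ (λ i → *-congʳ (u≈u′ i))

  ·-zero : ∀ {k} (u v : Vect k) → (∀ i → u i * v i ≈ 0#) → u · v ≈ 0#
  ·-zero {k} u v uv≈0 = trans (sum-cong-≋ uv≈0) (sum-replicate-zero k)

  ·-zeroʳ : ∀ {k} (u v : Vect k) → (∀ i → v i ≈ 0#) → u · v ≈ 0#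
  ·-zeroʳ u v v≈0 = ·-zero u v (λ i → trans (*-congˡ (v≈0 i)) (zeroʳ (u i)))

  ·-removeAt : ∀ {k} (u v : Vect (suc k)) i → u · v ≈ u i * v i + removeAt u i · removeAt v i
  ·-removeAt u v i = sum-remove {i = i} (λ j → u j * v j)

  ·-single : ∀ {k} (u v : Vect k) i → (∀ {j} → j ≢ i → u j * v j ≈ 0#) → u · v ≈ u i * v i
  ·-single {suc k} u v i others≈0 = begin
    u · v                                     ≈⟨ ·-removeAt u v i ⟩
    u i * v i + removeAt u i · removeAt v i   ≈⟨ +-congˡ (·-zero _ _ (λ j → others≈0 {punchIn i j} (punchInᵢ≢i i j))) ⟩
    u i * v i + 0#                            ≈⟨ +-identityʳ _ ⟩
    u i * v i                                 ∎

  ·-insertAt : ∀ {k} (u : Vect k) i a (v : Vect (suc k)) →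
    insertAt u i a · v ≈ a * v i + u · removeAt v i
  ·-insertAt u i a v = trans (·-removeAt (insertAt u i a) v i)
    (+-cong (*-congʳ (reflexive (insertAt-lookup u i a)))
            (sum-cong-≋ (λ j → *-congʳ (reflexive (insertAt-punchIn u i a j)))))

  ·-transpose : ∀ {m k} (u : Vect m) (M : Fin m → Vect k) (v : Vect k) →
    (λ j → u · (λ i → M i j)) · v ≈ u · (λ i → M i · v)
  ·-transpose {m} {k} u M v = begin
    ∑[ j < k ] (∑[ i < m ] (u i * M i j) * v j)   ≈⟨ sum-cong-≋ (λ j → *-distribʳ-sum (v j) (λ i → u i * M i j)) ⟩
    ∑[ j < k ] ∑[ i < m ] (u i * M i j * v j)     ≈⟨ ∑-comm (λ j i → u i * M i j * v j) ⟩
    ∑[ i < m ] ∑[ j < k ] (u i * M i j * v j)     ≈⟨ sum-cong-≋ (λ i → sum-cong-≋ (λ j → *-assoc (u i) (M i j) (v j))) ⟩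
    ∑[ i < m ] ∑[ j < k ] (u i * (M i j * v j))   ≈⟨ sum-cong-≋ (λ i → *-distribˡ-sum (u i) (λ j → M i j * v j)) ⟨
    u · (λ i → M i · v)                           ∎

  x+a*0≈x : ∀ {x y} a → y ≈ 0# → x + a * y ≈ x
  x+a*0≈x {x} a y≈0 = trans (+-congˡ (trans (*-congˡ y≈0) (zeroʳ a))) (+-identityʳ x)

  x*y≈0⇒x≈0 : ∀ {x y} → x * y ≈ 0# → ¬ y ≈ 0# → x ≈ 0#
  x*y≈0⇒x≈0 {x} {y} xy≈0 y≉0 = let (y⁻¹ , yy⁻¹≈1) = inverse y y≉0 in begin
    x              ≈⟨ *-identityʳ x ⟨
    x * 1#         ≈⟨ *-congˡ yy⁻¹≈1 ⟨
    x * (y * y⁻¹)  ≈⟨ *-assoc x y y⁻¹ ⟨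
    x * y * y⁻¹    ≈⟨ *-congʳ xy≈0 ⟩
    0# * y⁻¹       ≈⟨ zeroˡ y⁻¹ ⟩
    0#             ∎

  ∃-quotient : ∀ x {y} → ¬ y ≈ 0# → ∃ λ i → x ≈ enum i * y
  ∃-quotient x {y} y≉0 =
    let (y⁻¹ , yy⁻¹≈1) = inverse y y≉0
        (i , enum-i≈xy⁻¹) = enum-sur (x * y⁻¹)
    in i , (begin
      x              ≈⟨ *-identityʳ x ⟨
      x * 1#         ≈⟨ *-congˡ yy⁻¹≈1 ⟨
      x * (y * y⁻¹)  ≈⟨ *-congˡ (*-comm y y⁻¹) ⟩
      x * (y⁻¹ * y)  ≈⟨ *-assoc x y⁻¹ y ⟨
      x * y⁻¹ * y    ≈⟨ *-congʳ enum-i≈xy⁻¹ ⟨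
      enum i * y     ∎)

  x≈ay⇒x-ay≈0 : ∀ {x a y} → x ≈ a * y → x + - a * y ≈ 0#
  x≈ay⇒x-ay≈0 {x} {a} {y} x≈ay = begin
    x + - a * y       ≈⟨ +-congʳ x≈ay ⟩
    a * y + - a * y   ≈⟨ distribʳ y a (- a) ⟨
    (a + - a) * y     ≈⟨ *-congʳ (-‿inverseʳ a) ⟩
    0# * y            ≈⟨ zeroˡ y ⟩
    0#                ∎

  ∃-root : ∀ x {y} → ¬ y ≈ 0# → ∃ λ i → x + enum i * y ≈ 0#
  ∃-root x y≉0 =
    let (a , x≈ay) = ∃-quotient x y≉0
        (i , enum-i≈-a) = enum-sur (- enum a)
    in i , trans (+-congˡ (*-congʳ enum-i≈-a)) (x≈ay⇒x-ay≈0 x≈ay)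

  record PivotedFamily (r k : ℕ) {p} (P : Vect k → Set p) : Set (c ⊔ ℓ ⊔ p) where
    field
      member    : Fin r → Vect k
      pivot     : Fin r → Fin k
      at-pivot  : ∀ a → member a (pivot a) ≈ 1#
      off-pivot : ∀ {a b} → a ≢ b → member a (pivot b) ≈ 0#
      satisfies : ∀ a → P (member a)

  weaken : ∀ {r k p p′} {P : Vect k → Set p} {Q : Vect k → Set p′} →
    (∀ {u} → P u → Q u) → PivotedFamily r k P → PivotedFamily r k Q
  weaken P⇒Q S = record
    { member = member ; pivot = pivot ; at-pivot = at-pivot ; off-pivot = off-pivot
    ; satisfies = P⇒Q ∘ satisfies }
    where open PivotedFamily S

  Solves : ∀ {k} → List (Vect k) → Vect k → Set (c ⊔ ℓ)
  Solves es u = All (λ e → u · e ≈ 0#) es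

  standard-family : ∀ {r k} → r ≤ k → PivotedFamily r k (Solves [])
  standard-family {r} {k} r≤k = record
    { member    = unit ∘ pivot
    ; pivot     = pivot
    ; at-pivot  = λ a → unit-same (pivot a)
    ; off-pivot = λ a≢b → unit-other (a≢b ∘ inject≤-injective r≤k r≤k _ _)
    ; satisfies = λ _ → []
    }
    where
    pivot : Fin r → Fin k
    pivot a = inject≤ a r≤k
    unit : Fin k → Vect k
    unit i j = if does (i Fin.≟ j) then 1# else 0#
    unit-same : ∀ i → unit i i ≈ 1#
    unit-same i with i Fin.≟ i
    ... | yes _  = refl
    ... | no i≢i = ⊥-elim (i≢i ≡.refl)
    unit-other : ∀ {i j} → i ≢ j → unit i j ≈ 0#
    unit-other {i} {j} i≢j with i Fin.≟ j
    ... | yes i≡j = ⊥-elim (i≢j i≡j)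
    ... | no _    = refl

  -- Gaussian elimination on the pivot p of e: `reduce` removes the p-th variable from the
  -- other equations, and `lift` solves e for it.
  module Elimination {k} (e : Vect (suc k)) (p : Fin (suc k)) (ε : Carrier) (epε≈1 : e p * ε ≈ 1#) where

    reduce : Vect (suc k) → Vect k
    reduce f i = removeAt f p i + - (f p * ε) * removeAt e p i

    lift : Vect k → Vect (suc k)
    lift u = insertAt u p (- (u · removeAt e p * ε))

    lift-solves-e : ∀ u → lift u · e ≈ 0#
    lift-solves-e u = begin
      lift u · e                ≈⟨ ·-insertAt u p _ e ⟩
      - (L * ε) * e p + L       ≈⟨ +-congʳ (-‿distribˡ-* (L * ε) (e p)) ⟨
      - (L * ε * e p) + L       ≈⟨ +-congʳ (-‿cong (*-assoc L ε (e p))) ⟩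
      - (L * (ε * e p)) + L     ≈⟨ +-congʳ (-‿cong (*-congˡ (trans (*-comm ε (e p)) epε≈1))) ⟩
      - (L * 1#) + L            ≈⟨ +-congʳ (-‿cong (*-identityʳ L)) ⟩
      - L + L                   ≈⟨ -‿inverseˡ L ⟩
      0#                        ∎
      where L = u · removeAt e p

    lift-solves : ∀ u f → u · reduce f ≈ 0# → lift u · f ≈ 0#
    lift-solves u f u·rf≈0 = begin
      lift u · f                         ≈⟨ ·-insertAt u p _ f ⟩
      - (L * ε) * f p + u · removeAt f p ≈⟨ +-cong swap refl ⟩
      - (f p * ε) * L + u · removeAt f p ≈⟨ +-comm _ _ ⟩
      u · removeAt f p + - (f p * ε) * L ≈⟨ ·-linearʳ u (removeAt f p) (removeAt e p) _ ⟨
      u · reduce f                       ≈⟨ u·rf≈0 ⟩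
      0#                                 ∎
      where
      L = u · removeAt e p
      swap : - (L * ε) * f p ≈ - (f p * ε) * L
      swap = begin
        - (L * ε) * f p    ≈⟨ -‿distribˡ-* (L * ε) (f p) ⟨
        - (L * ε * f p)    ≈⟨ -‿cong (solve 3 (λ L ε f → L :* ε :* f := f :* ε :* L) refl L ε (f p)) ⟩
        - (f p * ε * L)    ≈⟨ -‿distribˡ-* (f p * ε) L ⟩
        - (f p * ε) * L    ∎

    eliminate : ∀ {r es} → PivotedFamily r k (Solves (map reduce es)) →
      PivotedFamily r (suc k) (Solves (e ∷ es))
    eliminate S = record
      { member    = lift ∘ member
      ; pivot     = punchIn p ∘ pivot
      ; at-pivot  = λ a → trans (reflexive (insertAt-punchIn (member a) p _ (pivot a))) (at-pivot a)
      ; off-pivot = λ {a} {b} a≢b →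
          trans (reflexive (insertAt-punchIn (member a) p _ (pivot b))) (off-pivot a≢b)
      ; satisfies = λ a → lift-solves-e (member a) ∷
          All.map (λ {f} → lift-solves (member a) f) (map⁻ (satisfies a))
      }
      where open PivotedFamily S

  solutions : ∀ k r (es : List (Vect k)) → length es ℕ.+ r ≤ k → PivotedFamily r k (Solves es)
  solutions k       r []       r≤k              = standard-family r≤k
  -- A `with` here would hide the lexicographic descent on (k, es) from the termination checker.
  solutions (suc k) r (e ∷ es) (s≤s |es|+r≤k) =
    [ (λ e≈0 → weaken (λ {u} → ·-zeroʳ u e e≈0 ∷_) (solutions (suc k) r es (m≤n⇒m≤1+n |es|+r≤k)))
    , (λ e≉0 →
        let (p , ep≉0) = ¬∀⟶∃¬ _ _ (λ i → e i ≟ 0#) e≉0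
            (ε , epε≈1) = inverse (e p) ep≉0
            open Elimination e p ε epε≈1
        in eliminate (solutions k r (map reduce es)
             (≡.subst (λ m → m ℕ.+ r ≤ k) (≡.sym (length-map reduce es)) |es|+r≤k)))
    ]′ (toSum (all? (λ i → e i ≟ 0#)))

module HammingWeight {c ℓ : Level} {q : ℕ} (F : FiniteField c ℓ q) where
  open FiniteField F using (Carrier; _≈_; _≟_; 0#; _+_; _*_; enum; trans)
  open Codes F using (Vect; weight; IsZeroVec)
  open LinearAlgebra F using (x+a*0≈x; ∃-root)
  open Counting
  open import Data.Nat as ℕ using (_≤_)
  import Data.Nat.Properties as ℕₚ
  open ℕₚ using (≤-reflexive; module ≤-Reasoning)
  open import Relation.Nullary.Decidable using (¬?)

  isNonzero : Carrier → Bool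
  isNonzero x = does (¬? (x ≟ 0#))

  support : ∀ {n} → Vect n → Fin n → Bool
  support v j = isNonzero (v j)

  weight≡∣support∣ : ∀ {n} (v : Vect n) → weight v ≡ ∣ support v ∣
  weight≡∣support∣ v = length-filter-tabulate (λ j → ¬? (v j ≟ 0#)) id

  isNonzero-≈0 : ∀ {x} → x ≈ 0# → isNonzero x ≡ false
  isNonzero-≈0 {x} x≈0 with x ≟ 0#
  ... | yes _   = ≡.refl
  ... | no x≉0 = ⊥-elim (x≉0 x≈0)

  isNonzero-≉0 : ∀ {x} → ¬ x ≈ 0# → T (isNonzero x)
  isNonzero-≉0 {x} x≉0 with x ≟ 0#
  ... | yes x≈0 = x≉0 x≈0
  ... | no _    = _

  T-isNonzero : ∀ {x} → T (isNonzero x) → ¬ x ≈ 0#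
  T-isNonzero {x} nz with x ≟ 0#
  ... | no x≉0 = x≉0

  1≤weight : ∀ {n} {v : Vect n} → ¬ IsZeroVec v → 1 ≤ weight v
  1≤weight {n} {v} v≢0 =
    let (j , vj≉0) = ¬∀⟶∃¬ n _ (λ j → v j ≟ 0#) v≢0
    in ≡.subst (1 ≤_) (≡.sym (weight≡∣support∣ v)) (1≤∣∣ (support v) (isNonzero-≉0 vj≉0))

  pencil-column : Carrier → Carrier → ℕ
  pencil-column x y = 𝟙 (isNonzero y) ℕ.+ ∣ (λ a → isNonzero (x + enum a * y)) ∣

  pencil-column-≤ : ∀ x y → pencil-column x y ≤ q
  pencil-column-≤ x y with y ≟ 0#
  ... | yes _   = ∣∣≤n _
  ... | no y≉0 = let (a , x+ay≈0) = ∃-root x y≉0 in ∣∣<n _ (isNonzero-≈0 x+ay≈0)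

  pencil-column-zero : ∀ {x y} → x ≈ 0# → y ≈ 0# → pencil-column x y ≡ 0
  pencil-column-zero {x} {y} x≈0 y≈0 = ≡.cong₂ ℕ._+_ (≡.cong 𝟙 (isNonzero-≈0 y≈0))
    (≡.trans (sum-cong-≗ (λ a → ≡.cong 𝟙 (isNonzero-≈0 (trans (x+a*0≈x (enum a) y≈0) x≈0)))) (∣∅∣≡0 q))

  pencil-weights : ∀ {n} (v w : Vect n) (Z : Fin n → Bool) →
    (∀ {j} → T (Z j) → v j ≈ 0# × w j ≈ 0#) →
    weight w ℕ.+ ∑[ a < q ] weight (λ j → v j + enum a * w j) ℕ.+ q ℕ.* ∣ Z ∣ ≤ q ℕ.* n
  pencil-weights {n} v w Z Z⇒0 = begin
    weight w ℕ.+ ∑[ a < q ] weight (λ j → v j + enum a * w j) ℕ.+ q ℕ.* ∣ Z ∣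
      ≡⟨ ≡.cong₂ (λ s t → s ℕ.+ t ℕ.+ q ℕ.* ∣ Z ∣) (weight≡∣support∣ w)
           (sum-cong-≗ (λ a → weight≡∣support∣ (λ j → v j + enum a * w j))) ⟩
    ∣ support w ∣ ℕ.+ ∑[ a < q ] ∑[ j < n ] 𝟙 (isNonzero (v j + enum a * w j)) ℕ.+ q ℕ.* ∣ Z ∣
      ≡⟨ ≡.cong₂ (λ s t → ∣ support w ∣ ℕ.+ s ℕ.+ t)
           (∑-comm (λ a j → 𝟙 (isNonzero (v j + enum a * w j)))) (*-distribˡ-sum q (𝟙 ∘ Z)) ⟩
    ∣ support w ∣ ℕ.+ ∑[ j < n ] ∑[ a < q ] 𝟙 (isNonzero (v j + enum a * w j))
      ℕ.+ ∑[ j < n ] (q ℕ.* 𝟙 (Z j))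
      ≡⟨ ≡.cong (ℕ._+ ∑[ j < n ] (q ℕ.* 𝟙 (Z j))) (≡.sym (∑-distrib-+ (𝟙 ∘ support w) _)) ⟩
    ∑[ j < n ] pencil-column (v j) (w j) ℕ.+ ∑[ j < n ] (q ℕ.* 𝟙 (Z j))
      ≡⟨ ∑-distrib-+ (λ j → pencil-column (v j) (w j)) (λ j → q ℕ.* 𝟙 (Z j)) ⟨
    ∑[ j < n ] (pencil-column (v j) (w j) ℕ.+ q ℕ.* 𝟙 (Z j))
      ≤⟨ sum-≤-* q column-bound ⟩
    n ℕ.* q
      ≡⟨ ℕₚ.*-comm n q ⟩
    q ℕ.* n ∎
    where
    open ≤-Reasoning
    column-bound : ∀ j → pencil-column (v j) (w j) ℕ.+ q ℕ.* 𝟙 (Z j) ≤ q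
    column-bound j with Z j in eq
    ... | true  = let (vj≈0 , wj≈0) = Z⇒0 (≡.subst T (≡.sym eq) _) in
      ≤-reflexive (≡.cong₂ ℕ._+_ (pencil-column-zero vj≈0 wj≈0) (ℕₚ.*-identityʳ q))
    ... | false = ℕₚ.≤-trans (≤-reflexive (≡.trans (≡.cong (pencil-column (v j) (w j) ℕ.+_) (ℕₚ.*-zeroʳ q))
                                                     (ℕₚ.+-identityʳ _)))
                             (pencil-column-≤ (v j) (w j))


module CodeBounds {c ℓ : Level} {q : ℕ} (F : FiniteField c ℓ q) {k n : ℕ} (G : Codes.Matrix F k n)
  (nondegenerate : Codes.IsNonDegGenerator F G) {d : ℕ}
  (min-distance : Codes.IsMinDistance F (Codes.InCode F G) d) where

  open FiniteField F hiding (zero)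
  open Codes F
  open LinearAlgebra F
  open HammingWeight F
  open Counting
  open import Data.Nat as ℕ using (_≤_; _<_; _∸_)
  import Data.Nat.Properties as ℕₚ
  open import Data.Fin.Patterns using (0F; 1F; 2F)
  open import Data.List using (map)
  open import Data.List.Properties using (length-map)
  open import Data.List.Membership.Propositional.Properties using (∈-map⁺; ∈-filter⁺; ∈-allFin)
  import Data.List.Relation.Unary.All as All
  import Relation.Binary.Reasoning.Setoid as SetoidReasoning

  column : Fin n → Vect k
  column j i = G i j

  encode≡· : ∀ x j → encode G x j ≡ x · column j
  encode≡· x j = sumF≡sum k (λ i → x i * G i j)

  encode-linear : ∀ u v a j → encode G (λ i → u i + a * v i) j ≈ encode G u j + a * encode G v j
  encode-linear u v a j = begin
    encode G (λ i → u i + a * v i) j     ≡⟨ encode≡· _ j ⟩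
    (λ i → u i + a * v i) · column j     ≈⟨ ·-linearˡ u v (column j) a ⟩
    u · column j + a * (v · column j)    ≡⟨ ≡.cong₂ (λ s t → s + a * t) (encode≡· u j) (encode≡· v j) ⟨
    encode G u j + a * encode G v j      ∎
    where open SetoidReasoning setoid

  encode-orthogonal : ∀ x {y} → InDual G y → encode G x · y ≈ 0#
  encode-orthogonal x {y} y∈C⊥ = begin
    encode G x · y                  ≈⟨ ·-congˡ y (λ j → reflexive (encode≡· x j)) ⟩
    (λ j → x · column j) · y        ≈⟨ ·-transpose x G y ⟩
    x · (λ i → G i · y)             ≈⟨ ·-zeroʳ x _ (λ i → trans (reflexive (≡.sym (sumF≡sum n _))) (y∈C⊥ i)) ⟩
    0#                              ∎
    where open SetoidReasoning setoid

  d≤weight : ∀ (x : Vect k) p → x p ≈ 1# → (w : Vect n) → (∀ j → w j ≈ encode G x j) → d ≤ weight w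
  d≤weight x p xp≈1 w w≈xG = proj₂ min-distance w (x , w≈xG) λ w≈0 →
    1≉0 (trans (sym xp≈1) (proj₁ nondegenerate x (λ j → trans (sym (w≈xG j)) (w≈0 j)) p))

  VanishesOn : (Fin n → Bool) → Vect k → Set ℓ
  VanishesOn Z x = ∀ {j} → T (Z j) → encode G x j ≈ 0#

  vanishing-family : ∀ r (Z : Fin n → Bool) → ∣ Z ∣ ℕ.+ r ≤ k → PivotedFamily r k (VanishesOn Z)
  vanishing-family r Z ∣Z∣+r≤k = weaken solves⇒vanishes (solutions k r equations |equations|+r≤k)
    where
    equations : List (Vect k)
    equations = map column (filterᵇ Z (allFin n))
    |equations|+r≤k : length equations ℕ.+ r ≤ k
    |equations|+r≤k = ≡.subst (λ m → m ℕ.+ r ≤ k)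
      (≡.sym (≡.trans (length-map column (filterᵇ Z (allFin n))) (length-filter-tabulate (T? ∘ Z) id))) ∣Z∣+r≤k
    solves⇒vanishes : ∀ {x} → Solves equations x → VanishesOn Z x
    solves⇒vanishes {x} sol {j} Zj = trans (reflexive (encode≡· x j))
      (All.lookup sol (∈-map⁺ column (∈-filter⁺ (T? ∘ Z) (∈-allFin j) Zj)))

  vanishes-at-dual-support-point : ∀ {x y j₀} → InDual G y → ¬ y j₀ ≈ 0# →
    (∀ {j} → j ≢ j₀ → T (support y j) → encode G x j ≈ 0#) → encode G x j₀ ≈ 0#
  vanishes-at-dual-support-point {x} {y} {j₀} y∈C⊥ yj₀≉0 vanishes = x*y≈0⇒x≈0 (begin
    encode G x j₀ * y j₀   ≈⟨ ·-single (encode G x) y j₀ term≈0 ⟨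
    encode G x · y         ≈⟨ encode-orthogonal x y∈C⊥ ⟩
    0#                     ∎) yj₀≉0
    where
    open SetoidReasoning setoid
    term≈0 : ∀ {j} → j ≢ j₀ → encode G x j * y j ≈ 0#
    term≈0 {j} j≢j₀ with y j ≟ 0#
    ... | yes yj≈0 = trans (*-congˡ yj≈0) (zeroʳ _)
    ... | no  yj≉0 = trans (*-congʳ (vanishes j≢j₀ (isNonzero-≉0 yj≉0))) (zeroˡ _)

  -- The pivot conditions make v and every u + a v nonzero, hence of weight at least d.
  record Pencil (m : ℕ) : Set (c ⊔ ℓ) where
    field
      u v        : Vect k
      p p′       : Fin k
      u-p≈1      : u p ≈ 1#
      v-p≈0      : v p ≈ 0#
      v-p′≈1     : v p′ ≈ 1#
      zeros      : Fin n → Bool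
      m≤∣zeros∣  : m ≤ ∣ zeros ∣
      u-vanishes : VanishesOn zeros u
      v-vanishes : VanishesOn zeros v

  pencil-bound : ∀ {m} → Pencil m → ℕ.suc q ℕ.* d ℕ.+ q ℕ.* m ≤ q ℕ.* n
  pencil-bound {m} P = ℕₚ.≤-trans
    (ℕₚ.+-mono-≤ (ℕₚ.+-mono-≤ d≤weight-v (*-≤-sum d d≤weight-u+av)) (ℕₚ.*-monoʳ-≤ q m≤∣zeros∣))
    (pencil-weights (encode G u) (encode G v) zeros (λ Zj → u-vanishes Zj , v-vanishes Zj))
    where
    open Pencil P
    d≤weight-v : d ≤ weight (encode G v)
    d≤weight-v = d≤weight v p′ v-p′≈1 (encode G v) (λ _ → refl)
    d≤weight-u+av : ∀ a → d ≤ weight (λ j → encode G u j + enum a * encode G v j)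
    d≤weight-u+av a = d≤weight (λ i → u i + enum a * v i) p (trans (x+a*0≈x (enum a) v-p≈0) u-p≈1)
      _ (λ j → sym (encode-linear u v (enum a) j))

  pencil-of-pair : ∀ {m Z} → m ≤ ∣ Z ∣ → PivotedFamily 2 k (VanishesOn Z) → Pencil m
  pencil-of-pair {Z = Z} m≤∣Z∣ S = record
    { u = member 0F ; v = member 1F ; p = pivot 0F ; p′ = pivot 1F
    ; u-p≈1 = at-pivot 0F ; v-p≈0 = off-pivot (λ ()) ; v-p′≈1 = at-pivot 1F
    ; zeros = Z ; m≤∣zeros∣ = m≤∣Z∣ ; u-vanishes = satisfies 0F ; v-vanishes = satisfies 1F
    }
    where open PivotedFamily S

  pencil-generic : 2 ≤ k → k ≤ n → Pencil (k ∸ 2)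
  pencil-generic 2≤k k≤n =
    let (Z , ∣Z∣≡k∸2) = ∃-subset-of-size (k ∸ 2) (ℕₚ.≤-trans (ℕₚ.m∸n≤m k 2) k≤n)
    in pencil-of-pair (ℕₚ.≤-reflexive (≡.sym ∣Z∣≡k∸2)) (vanishing-family 2 Z
         (ℕₚ.≤-reflexive (≡.trans (≡.cong (ℕ._+ 2) ∣Z∣≡k∸2) (ℕₚ.m∸n+n≡m 2≤k))))

  vanishes-on-dual-support : ∀ {y j₀ Z x} → InDual G y → ¬ y j₀ ≈ 0# → support y ⊆ Z →
    VanishesOn (Z ∖ j₀) x → VanishesOn Z x
  vanishes-on-dual-support {j₀ = j₀} {Z} y∈C⊥ yj₀≉0 supp⊆Z vanishes {j} Zj with j Fin.≟ j₀
  ... | yes ≡.refl = vanishes-at-dual-support-point y∈C⊥ yj₀≉0 (λ j≢j₀ yj≉0 → vanishes (∈-∖ Z (supp⊆Z yj≉0) j≢j₀))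
  ... | no  j≢j₀   = vanishes (∈-∖ Z Zj j≢j₀)

  pencil-dual : 2 ≤ k → k ≤ n → ∀ {y} → InDual G y → ¬ IsZeroVec y → weight y < k → Pencil (k ∸ 2 ℕ.+ 1)
  pencil-dual (ℕ.s≤s (ℕ.s≤s _)) k≤n {y} y∈C⊥ y≢0 weight-y<k =
    let (j₀ , yj₀≉0) = ¬∀⟶∃¬ n _ (λ j → y j ≟ 0#) y≢0
        (Z , supp⊆Z , ∣Z∣≡k∸1) = ∃-superset-of-size (support y) (k ∸ 1)
          (≡.subst (_≤ k ∸ 1) (weight≡∣support∣ y) (ℕₚ.≤-pred weight-y<k)) (ℕₚ.≤-trans (ℕₚ.n≤1+n _) k≤n)
        suc∣Z∖j₀∣≡∣Z∣ = ∣∖∣ Z (supp⊆Z (isNonzero-≉0 yj₀≉0))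
    in pencil-of-pair (ℕₚ.≤-reflexive (≡.trans (ℕₚ.+-comm _ 1) (≡.sym ∣Z∣≡k∸1)))
         (weaken (λ {x} → vanishes-on-dual-support {x = x} y∈C⊥ yj₀≉0 supp⊆Z)
           (vanishing-family 2 (Z ∖ j₀)
             (ℕₚ.≤-reflexive (≡.trans (ℕₚ.+-comm _ 2) (≡.cong ℕ.suc (≡.trans suc∣Z∖j₀∣≡∣Z∣ ∣Z∣≡k∸1))))))

  module LargeDistance (α : ℕ) (q²α<d : q ℕ.* (q ℕ.* α) < d) (Z : Fin n → Bool)
    (S : PivotedFamily 3 k (VanishesOn Z)) where

    open PivotedFamily S

    c₀ c₁ c₂ : Vect n
    c₀ = encode G (member 0F)
    c₁ = encode G (member 1F)
    c₂ = encode G (member 2F)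

    K : Fin q → Fin q → Fin n → Bool
    K a b j = isNonzero (c₀ j) ∧ ⌊ c₁ j ≟ (enum a * c₀ j) ⌋ ∧ ⌊ c₂ j ≟ (enum b * c₀ j) ⌋

    K-spec : ∀ {a b j} → T (K a b j) → ¬ c₀ j ≈ 0# × c₁ j ≈ enum a * c₀ j × c₂ j ≈ enum b * c₀ j
    K-spec {a} {b} {j} Kj =
      let (c₀j≉0 , rest) = Equivalence.to (T-∧ {isNonzero (c₀ j)}) Kj
          (c₁j≈ac₀j , c₂j≈bc₀j) = Equivalence.to (T-∧ {⌊ c₁ j ≟ (enum a * c₀ j) ⌋}) rest
      in T-isNonzero c₀j≉0 , toWitness c₁j≈ac₀j , toWitness c₂j≈bc₀j

    K-intro : ∀ {a b j} → T (isNonzero (c₀ j)) → c₁ j ≈ enum a * c₀ j → c₂ j ≈ enum b * c₀ j → T (K a b j)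
    K-intro {a} {b} {j} c₀j≢0 c₁j≈ac₀j c₂j≈bc₀j = Equivalence.from (T-∧ {isNonzero (c₀ j)})
      (c₀j≢0 , Equivalence.from (T-∧ {⌊ c₁ j ≟ (enum a * c₀ j) ⌋})
        (fromWitness c₁j≈ac₀j , fromWitness c₂j≈bc₀j))

    K-covers-support : ∀ j → 𝟙 (support c₀ j) ≤ ∑[ a < q ] ∑[ b < q ] 𝟙 (K a b j)
    K-covers-support j = 𝟙≤ λ c₀j≢0 →
      let (a , c₁j≈ac₀j) = ∃-quotient (c₁ j) (T-isNonzero c₀j≢0)
          (b , c₂j≈bc₀j) = ∃-quotient (c₂ j) (T-isNonzero c₀j≢0)
      in ℕₚ.≤-trans (T⇒1≤𝟙 (K-intro {a} {b} c₀j≢0 c₁j≈ac₀j c₂j≈bc₀j))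
           (ℕₚ.≤-trans (≤-sum (λ b → 𝟙 (K a b j)) b) (≤-sum (λ a → ∑[ b < q ] 𝟙 (K a b j)) a))

    many-in-K : q ℕ.* (q ℕ.* α) < ∑[ a < q ] ∑[ b < q ] ∣ K a b ∣
    many-in-K = begin-strict
      q ℕ.* (q ℕ.* α)                             <⟨ q²α<d ⟩
      d                                           ≤⟨ d≤weight (member 0F) (pivot 0F) (at-pivot 0F) c₀ (λ _ → refl) ⟩
      weight c₀                                   ≡⟨ weight≡∣support∣ c₀ ⟩
      ∣ support c₀ ∣                              ≤⟨ sum-mono-≤ K-covers-support ⟩
      ∑[ j < n ] ∑[ a < q ] ∑[ b < q ] 𝟙 (K a b j) ≡⟨ ∑-comm (λ j a → ∑[ b < q ] 𝟙 (K a b j)) ⟩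
      ∑[ a < q ] ∑[ j < n ] ∑[ b < q ] 𝟙 (K a b j) ≡⟨ sum-cong-≗ (λ a → ∑-comm (λ j b → 𝟙 (K a b j))) ⟩
      ∑[ a < q ] ∑[ b < q ] ∣ K a b ∣              ∎
      where open ℕₚ.≤-Reasoning

    heavy-row : ∃ λ a → q ℕ.* α < ∑[ b < q ] ∣ K a b ∣
    heavy-row = pigeonhole (q ℕ.* α) _ many-in-K

    a : Fin q
    a = proj₁ heavy-row

    heavy-cell : ∃ λ b → α < ∣ K a b ∣
    heavy-cell = pigeonhole α _ (proj₂ heavy-row)

    b : Fin q
    b = proj₁ heavy-cell

    Z-disjoint-K : ∀ {j} → T (Z j) → T (K a b j) → ⊥
    Z-disjoint-K Zj Kj = proj₁ (K-spec Kj) (satisfies 0F Zj)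

    reduced-vanishes : ∀ {x e} → VanishesOn Z x → (∀ {j} → T (K a b j) → encode G x j ≈ e * c₀ j) →
      VanishesOn (Z ∪ K a b) (λ i → x i + - e * member 0F i)
    reduced-vanishes {x} {e} x-on-Z x-on-K {j} Z∪Kj = trans (encode-linear x (member 0F) (- e) j)
      ([ (λ Zj → trans (x+a*0≈x (- e) (satisfies 0F Zj)) (x-on-Z Zj))
       , (λ Kj → x≈ay⇒x-ay≈0 (x-on-K Kj))
       ]′ (Equivalence.to T-∨ Z∪Kj))

    pencil : ∀ {m} → m ≤ ∣ Z ∣ ℕ.+ ℕ.suc α → Pencil m
    pencil m≤∣Z∣+1+α = record
      { u          = λ i → member 1F i + - enum a * member 0F i
      ; v          = λ i → member 2F i + - enum b * member 0F i
      ; p          = pivot 1F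
      ; p′         = pivot 2F
      ; u-p≈1      = trans (x+a*0≈x _ (off-pivot (λ ()))) (at-pivot 1F)
      ; v-p≈0      = trans (x+a*0≈x _ (off-pivot (λ ()))) (off-pivot (λ ()))
      ; v-p′≈1     = trans (x+a*0≈x _ (off-pivot (λ ()))) (at-pivot 2F)
      ; zeros      = Z ∪ K a b
      ; m≤∣zeros∣  = ℕₚ.≤-trans m≤∣Z∣+1+α (ℕₚ.≤-trans (ℕₚ.+-monoʳ-≤ ∣ Z ∣ (proj₂ heavy-cell))
                       (ℕₚ.≤-reflexive (≡.sym (∣∪∣-disjoint Z (K a b) Z-disjoint-K))))
      ; u-vanishes = reduced-vanishes (satisfies 1F) (proj₁ ∘ proj₂ ∘ K-spec)
      ; v-vanishes = reduced-vanishes (satisfies 2F) (proj₂ ∘ proj₂ ∘ K-spec)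
      }

  pencil-large-d : 3 ≤ k → k ≤ n → ∀ α → q ℕ.* (q ℕ.* α) < d → Pencil (k ∸ 2 ℕ.+ α)
  pencil-large-d (ℕ.s≤s (ℕ.s≤s (ℕ.s≤s _))) k≤n α q²α<d =
    let (Z , ∣Z∣≡k∸3) = ∃-subset-of-size (k ∸ 3) (ℕₚ.≤-trans (ℕₚ.m∸n≤m k 3) k≤n)
    in LargeDistance.pencil α q²α<d Z
         (vanishing-family 3 Z (ℕₚ.≤-reflexive (≡.trans (ℕₚ.+-comm _ 3) (≡.cong (3 ℕ.+_) ∣Z∣≡k∸3))))
         (ℕₚ.≤-reflexive (≡.sym (≡.trans (≡.cong (ℕ._+ ℕ.suc α) ∣Z∣≡k∸3) (ℕₚ.+-suc _ α))))

module Arithmetic where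
  open import Data.Nat as ℕ using (_≤_; _<_; _∸_; _+_; _*_; s≤s)
  import Data.Nat.Properties as ℕₚ
  open import Data.Integer as ℤ using (ℤ; +_; +≤+) renaming (_+_ to _+ℤ_; _-_ to _-ℤ_; _*_ to _*ℤ_; _≤_ to _≤ℤ_; _<_ to _<ℤ_)
  import Data.Integer.Properties as ℤₚ
  import Data.Nat.Tactic.RingSolver as ℕ-Solver
  import Data.Integer.Tactic.RingSolver as ℤ-Solver
  open ≡ using (cong; sym; trans)

  dimension≤length : ∀ n k d s → 1 ≤ d → n + 1 ≡ k + d + s → k ≤ n
  dimension≤length n k d s 1≤d hs = ℕₚ.+-cancelʳ-≤ 1 k n (begin
    k + 1        ≤⟨ ℕₚ.+-monoʳ-≤ k 1≤d ⟩
    k + d        ≤⟨ ℕₚ.m≤m+n (k + d) s ⟩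
    k + d + s    ≡⟨ hs ⟨
    n + 1        ∎)
    where open ℕₚ.≤-Reasoning

  dual-distance<dimension : ∀ n k d⊥ t → k ≤ n → 2 ≤ t → n + 1 ≡ n ∸ k + d⊥ + t → d⊥ < k
  dual-distance<dimension n k d⊥ t k≤n 2≤t ht = ℕₚ.+-cancelʳ-≤ 1 (ℕ.suc d⊥) k (ℕₚ.+-cancelˡ-≤ (n ∸ k) _ _ (begin
    n ∸ k + (ℕ.suc d⊥ + 1)    ≡⟨ regroup (n ∸ k) d⊥ ⟩
    n ∸ k + d⊥ + 2            ≤⟨ ℕₚ.+-monoʳ-≤ (n ∸ k + d⊥) 2≤t ⟩
    n ∸ k + d⊥ + t            ≡⟨ ht ⟨
    n + 1                     ≡⟨ cong (_+ 1) (ℕₚ.m∸n+n≡m k≤n) ⟨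
    n ∸ k + k + 1             ≡⟨ ℕₚ.+-assoc (n ∸ k) k 1 ⟩
    n ∸ k + (k + 1)           ∎))
    where
    open ℕₚ.≤-Reasoning
    regroup : ∀ m x → m + (ℕ.suc x + 1) ≡ m + x + 2
    regroup = ℕ-Solver.solve-∀

  q²α<d : ∀ q d α → 2 ≤ α → (+ α *ℤ (+ (q * q) +ℤ + q)) -ℤ (+ 2 *ℤ + q) <ℤ + d → q * (q * α) < d
  q²α<d q d α 2≤α hα = ℕₚ.+-cancelʳ-< (2 * q) (q * (q * α)) d (begin-strict
    q * (q * α) + 2 * q       ≤⟨ ℕₚ.+-monoʳ-≤ (q * (q * α)) (ℕₚ.*-monoˡ-≤ q 2≤α) ⟩
    q * (q * α) + α * q       ≡⟨ ℕ-Solver.solve (q ∷ α ∷ []) ⟩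
    α * (q * q + q)           <⟨ ℤₚ.drop‿+<+ (≡.subst₂ _<ℤ_ lhs rhs (ℤₚ.+-monoˡ-< (+ 2 *ℤ + q) hα)) ⟩
    d + 2 * q                 ∎)
    where
    open ℕₚ.≤-Reasoning
    i-j+j≡i : ∀ i j → i -ℤ j +ℤ j ≡ i
    i-j+j≡i = ℤ-Solver.solve-∀
    lhs : (+ α *ℤ (+ (q * q) +ℤ + q)) -ℤ (+ 2 *ℤ + q) +ℤ (+ 2 *ℤ + q) ≡ + (α * (q * q + q))
    lhs = trans (i-j+j≡i _ _)
                (sym (trans (ℤₚ.pos-* α (q * q + q)) (cong (+ α *ℤ_) (ℤₚ.pos-+ (q * q) q))))
    rhs : + d +ℤ (+ 2 *ℤ + q) ≡ + (d + 2 * q)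
    rhs = sym (trans (ℤₚ.pos-+ d (2 * q)) (cong (+ d +ℤ_) (ℤₚ.pos-* 2 q)))

  n+qα+1≤qs+q+s+k : ∀ q k d s n α → 2 ≤ k → ℕ.suc q * d + q * (k ∸ 2 + α) ≤ q * n →
    n + 1 ≡ k + d + s → n + (q * α + 1) ≤ q * s + q + s + k
  n+qα+1≤qs+q+s+k q k@(ℕ.suc (ℕ.suc k′)) d s n α (s≤s (s≤s _)) pencil hs = begin
    n + (q * α + 1)          ≡⟨ ℕ-Solver.solve (n ∷ q ∷ α ∷ []) ⟩
    n + 1 + q * α            ≡⟨ cong (_+ q * α) hs ⟩
    k + d + s + q * α        ≡⟨ ℕ-Solver.solve (k′ ∷ d ∷ s ∷ q ∷ α ∷ []) ⟩
    k + s + (d + q * α)      ≤⟨ ℕₚ.+-monoʳ-≤ (k + s) d+qα≤qs+q ⟩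
    k + s + (q * s + q)      ≡⟨ ℕ-Solver.solve (k′ ∷ s ∷ q ∷ []) ⟩
    q * s + q + s + k        ∎
    where
    open ℕₚ.≤-Reasoning
    d+qα≤qs+q : d + q * α ≤ q * s + q
    d+qα≤qs+q = ℕₚ.+-cancelˡ-≤ (q * (k + d)) (d + q * α) (q * s + q) (begin
      q * (k + d) + (d + q * α)            ≡⟨ ℕ-Solver.solve (q ∷ k′ ∷ d ∷ α ∷ []) ⟩
      ℕ.suc q * d + q * (k′ + α) + 2 * q    ≤⟨ ℕₚ.+-monoˡ-≤ (2 * q) pencil ⟩
      q * n + 2 * q                        ≡⟨ ℕ-Solver.solve (q ∷ n ∷ []) ⟩
      q * (n + 1) + q                      ≡⟨ cong (λ m → q * m + q) hs ⟩
      q * (k + d + s) + q                  ≡⟨ ℕ-Solver.solve (q ∷ k′ ∷ d ∷ s ∷ []) ⟩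
      q * (k + d) + (q * s + q)            ∎)

  singleton-defect-bound : ∀ q k d s n α → 2 ≤ k → ℕ.suc q * d + q * (k ∸ 2 + α) ≤ q * n →
    n + 1 ≡ k + d + s → + n ≤ℤ ((+ s +ℤ + 1 -ℤ + α) *ℤ (+ q +ℤ + 1)) +ℤ + k -ℤ + 2 +ℤ + α
  singleton-defect-bound q k d s n α 2≤k pencil hs = begin
    + n                                   ≡⟨ i≡i+j-j (+ n) E ⟩
    + n +ℤ E -ℤ E                         ≡⟨ cong (_-ℤ E) lhs-cast ⟨
    + (n + (q * α + 1)) -ℤ E              ≤⟨ ℤₚ.+-monoˡ-≤ (ℤ.- E) (+≤+ (n+qα+1≤qs+q+s+k q k d s n α 2≤k pencil hs)) ⟩
    + (q * s + q + s + k) -ℤ E            ≡⟨ cong (_-ℤ E) rhs-cast ⟩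
    + q *ℤ + s +ℤ + q +ℤ + s +ℤ + k -ℤ E  ≡⟨ regroup (+ q) (+ s) (+ k) (+ α) ⟩
    ((+ s +ℤ + 1 -ℤ + α) *ℤ (+ q +ℤ + 1)) +ℤ + k -ℤ + 2 +ℤ + α ∎
    where
    open ℤₚ.≤-Reasoning
    E : ℤ
    E = + q *ℤ + α +ℤ + 1
    i≡i+j-j : ∀ i j → i ≡ i +ℤ j -ℤ j
    i≡i+j-j = ℤ-Solver.solve-∀
    regroup : ∀ q s k α → q *ℤ s +ℤ q +ℤ s +ℤ k -ℤ (q *ℤ α +ℤ + 1) ≡
                          ((s +ℤ + 1 -ℤ α) *ℤ (q +ℤ + 1)) +ℤ k -ℤ + 2 +ℤ α
    regroup = ℤ-Solver.solve-∀
    lhs-cast : + (n + (q * α + 1)) ≡ + n +ℤ E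
    lhs-cast = trans (ℤₚ.pos-+ n (q * α + 1))
      (cong (+ n +ℤ_) (trans (ℤₚ.pos-+ (q * α) 1) (cong (_+ℤ + 1) (ℤₚ.pos-* q α))))
    rhs-cast : + (q * s + q + s + k) ≡ + q *ℤ + s +ℤ + q +ℤ + s +ℤ + k
    rhs-cast = trans (ℤₚ.pos-+ (q * s + q + s) k) (cong (_+ℤ + k)
      (trans (ℤₚ.pos-+ (q * s + q) s) (cong (_+ℤ + s)
        (trans (ℤₚ.pos-+ (q * s) q) (cong (_+ℤ + q) (ℤₚ.pos-* q s))))))

-- Opened only now: inside the modules above, _+_ and _*_ are the field operations.
open import Data.Nat using (_+_; _∸_; _*_; _≤_; _<_; s≤s; z≤n)
open import Data.Integer using (ℤ; +_) renaming (_+_ to _+ℤ_; _-_ to _-ℤ_; _*_ to _*ℤ_; _≤_ to _≤ℤ_; _<_ to _<ℤ_)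
import Data.Nat.Properties as ℕₚ

mainTheorem13 : {c ℓ : Level} {q : ℕ} (F : FiniteField c ℓ q) →
    let open Codes F in
    (n k d s d⊥ t α : ℕ) (G : Matrix k n) →
    IsNonDegGenerator G →
    IsMinDistance (InCode G) d →
    n + 1 ≡ k + d + s →
    IsMinDistance (InDual G) d⊥ →
    n + 1 ≡ (n ∸ k) + d⊥ + t →
    3 ≤ k →
    2 ≤ t →
    (+ α *ℤ (+ (q * q) +ℤ + q)) -ℤ (+ 2 *ℤ + q) <ℤ + d →
    + n ≤ℤ ((+ s +ℤ + 1 -ℤ + α) *ℤ (+ q +ℤ + 1)) +ℤ + k -ℤ + 2 +ℤ + α
mainTheorem13 {q = q} F n k d s d⊥ t α G nondegenerate min-distance hs min-distance⊥ ht 3≤k 2≤t hα =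
  singleton-defect-bound q k d s n α 2≤k (pencil-bound (pencil α hα)) hs
  where
  open CodeBounds F G nondegenerate min-distance
  open HammingWeight F using (1≤weight)
  open Arithmetic
  2≤k : 2 ≤ k
  2≤k = ℕₚ.≤-trans (ℕₚ.n≤1+n 2) 3≤k
  k≤n : k ≤ n
  k≤n = let (_ , _ , v≢0 , weight-v≡d) = proj₁ min-distance
        in dimension≤length n k d s (≡.subst (1 ≤_) weight-v≡d (1≤weight v≢0)) hs
  pencil : ∀ α → (+ α *ℤ (+ (q * q) +ℤ + q)) -ℤ (+ 2 *ℤ + q) <ℤ + d → Pencil (k ∸ 2 + α)
  pencil 0 _ = ≡.subst Pencil (≡.sym (ℕₚ.+-identityʳ (k ∸ 2))) (pencil-generic 2≤k k≤n)
  pencil 1 _ =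
    let (y , y∈C⊥ , y≢0 , weight-y≡d⊥) = proj₁ min-distance⊥
    in pencil-dual 2≤k k≤n y∈C⊥ y≢0
         (≡.subst (_< k) (≡.sym weight-y≡d⊥) (dual-distance<dimension n k d⊥ t k≤n 2≤t ht))
  pencil α@(suc (suc _)) hα = pencil-large-d 3≤k k≤n α (q²α<d q d α (s≤s (s≤s z≤n)) hα)
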